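{- Let $n=2q+1$, $q\ge1$, and let $S=\{\{a_i,b_i\}\}_{i=1}^q$ be a 2-partition of $\mathbb{Z}_n^*$. Then one can choose, for each $i$, either $(x_i,y_i)=(a_i,b_i)$ or $(x_i,y_i)=(b_i,a_i)$, such that the set of ordered pairs $\bar S=\{(x_i,y_i)\}_{i=1}^q$ satisfies $\bigcup_{i=1}^q\{\pm x_i\}=\mathbb{Z}_n^*$.
   Context: $\mathbb{Z}_n^*=\mathbb{Z}_n\setminus\{0\}$. A 2-partition of $\mathbb{Z}_n^*$ is a partition of $\mathbb{Z}_n^*$ into unordered pairs. -}

module Defs where

open import Data.Nat using (ℕ; suc; _∸_)
open import Data.Nat.DivMod using (_mod_)
open import Data.Fin using (Fin; toℕ; zero; suc)
open import Data.Bool using (Bool; true; false)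
open import Data.Product using (Σ; ∃; ∃-syntax; _×_; _,_)
open import Relation.Binary.PropositionalEquality using (_≡_; _≢_)

-- Elements of ℤ_N (N = suc m) are represented by Fin (suc m), residues 0 … m.

negℤ : ∀ {m} → Fin (suc m) → Fin (suc m)
negℤ {m} z = (suc m ∸ toℕ z) mod (suc m)

pick : ∀ {q N} → (Fin q → Fin N) → (Fin q → Fin N) → Fin q → Bool → Fin N
pick a b i true  = a i
pick a b i false = b i

-- The family of unordered pairs {a i , b i} (i ∈ Fin q) is a 2-partition of
-- ℤ_N^* = ℤ_N ∖ {0}: the pairs consist of nonzero elements, they cover
-- ℤ_N^*, and they are pairwise disjoint with two distinct members each
-- (every element occurs in exactly one pair and exactly one position).
Is2Partition : ∀ {m} (q : ℕ) → (a b : Fin q → Fin (suc m)) → Set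
Is2Partition {m} q a b =
  (∀ i s → pick a b i s ≢ zero)
  × (∀ (z : Fin (suc m)) → z ≢ zero → ∃[ i ] ∃[ s ] pick a b i s ≡ z)
  × (∀ i j s t → pick a b i s ≡ pick a b j t → i ≡ j × s ≡ t)

{-# OPTIONS --safe #-}
-- The partner map (z ↦ the other element of z's pair) and negation are
-- fixed-point-free involutions of ℤ_n^*, the latter because n is odd.  Every
-- pair of such involutions admits a 2-colouring separating z from both of its
-- images, since their union is a disjoint union of even alternating cycles.
-- Choosing x_i to be the true-coloured member of each pair then works: every
-- z is either true-coloured, hence some x_i, or −z is.  The colouring is built
-- by induction on the set where two involutions p and ν disagree: rerouting
-- the ν-edges at a point x of disagreement into {x, p x} and {ν x, ν (p x)}
-- shrinks that set, and a colouring for the rerouted ν lifts back to ν.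
module Submission where

open import Defs
open import Level using (0ℓ)
open import Data.Nat using (ℕ; suc; _+_; _*_; _≥_; _∸_; s≤s)
open import Data.Nat.Properties
  using (m∸n≤m; m>n⇒m∸n≢0; m∸n+n≡m; m∸[m∸n]≡n; even≢odd; +-identityʳ; <⇒≤)
open import Data.Nat.DivMod using (m<n⇒m%n≡m; m%n<n)
open import Data.Fin using (Fin; zero; suc; toℕ)
open import Data.Fin.Properties
  using (_≟_; _<?_; <-cmp; toℕ-injective; toℕ<n; toℕ-fromℕ<)
open import Data.Fin.Subset using (Subset; _∈_; _∉_; _⊂_; Nonempty)
open import Data.Fin.Subset.Properties using (nonempty?)
open import Data.Fin.Subset.Induction using (Acc; acc; ⊂-wellFounded)
open import Data.Vec using (tabulate)
open import Data.Vec.Properties using (lookup∘tabulate; []=⇒lookup; lookup⇒[]=)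
open import Data.Bool using (Bool; true; false; not)
open import Data.Bool.Properties using (not-involutive; not-injective; not-¬; ¬-not)
open import Data.Product using (Σ; ∃-syntax; _×_; _,_; proj₁; proj₂; map₂)
open import Data.Sum using (_⊎_; inj₁; inj₂)
open import Function using (_∘_)
open import Relation.Nullary using (¬_; Dec; yes; no; does; contradiction)
open import Relation.Nullary.Decidable using (¬?; _×-dec_; _⊎-dec_; dec-true; dec-false)
open import Relation.Unary using (Pred; Decidable)
open import Relation.Binary using (tri<; tri≈; tri>)
open import Relation.Binary.PropositionalEquality
open ≡-Reasoning

record IsPerfectMatching {n} (S : Pred (Fin n) 0ℓ) (g : Fin n → Fin n) : Set where
  field
    closed      : ∀ {z} → S z → S (g z)
    no-fixpoint : ∀ {z} → S z → g z ≢ z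
    involutive  : ∀ {z} → S z → g (g z) ≡ z

open IsPerfectMatching

ProperColouring : ∀ {n} → Pred (Fin n) 0ℓ → (Fin n → Fin n) → (Fin n → Bool) → Set
ProperColouring S g f = ∀ {z} → S z → f (g z) ≢ f z

module _ {n} {S : Pred (Fin n) 0ℓ} where

  proper-cong : ∀ {g h f} → (∀ {z} → S z → g z ≡ h z) →
                ProperColouring S g f → ProperColouring S h f
  proper-cong {f = f} g≗h proper Sz = subst (λ w → f w ≢ _) (g≗h Sz) (proper Sz)

  does-<?-antisym : ∀ {i j : Fin n} → i ≢ j → does (i <? j) ≢ does (j <? i)
  does-<?-antisym {i} {j} i≢j with <-cmp i j
  ... | tri< i<j _ j≮i rewrite dec-true (i <? j) i<j | dec-false (j <? i) j≮i = λ ()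
  ... | tri≈ _ i≡j _ = contradiction i≡j i≢j
  ... | tri> i≮j _ j<i rewrite dec-false (i <? j) i≮j | dec-true (j <? i) j<i = λ ()

  order-colouring-proper : ∀ {p} → IsPerfectMatching S p →
                           ProperColouring S p (λ z → does (z <? p z))
  order-colouring-proper {p} P {z} Sz eq =
    does-<?-antisym (≢-sym (no-fixpoint P Sz))
      (sym (subst (λ w → does (p z <? w) ≡ does (z <? p z)) (involutive P Sz) eq))

  disagreement : Decidable S → (p ν : Fin n → Fin n) → Subset n
  disagreement S? p ν = tabulate λ z → does (S? z ×-dec ¬? (ν z ≟ p z))

  module _ (S? : Decidable S) (p ν : Fin n → Fin n) where

    ∈-disagreement⁺ : ∀ {z} → S z → ν z ≢ p z → z ∈ disagreement S? p ν
    ∈-disagreement⁺ {z} Sz ν≢p = lookup⇒[]= z _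
      (trans (lookup∘tabulate _ z) (dec-true (S? z ×-dec ¬? (ν z ≟ p z)) (Sz , ν≢p)))

    ∈-disagreement⁻ : ∀ {z} → z ∈ disagreement S? p ν → S z × ν z ≢ p z
    ∈-disagreement⁻ {z} z∈ = witness (S? z ×-dec ¬? (ν z ≟ p z))
      (trans (sym (lookup∘tabulate _ z)) ([]=⇒lookup z∈))
      where
      witness : ∀ {A : Set} (a? : Dec A) → does a? ≡ true → A
      witness (yes a) _ = a

    disagreement-empty : ¬ Nonempty (disagreement S? p ν) → ∀ {z} → S z → ν z ≡ p z
    disagreement-empty empty {z} Sz with ν z ≟ p z
    ... | yes ν≡p = ν≡p
    ... | no  ν≢p = contradiction (z , ∈-disagreement⁺ Sz ν≢p) empty

  module Switch {p ν : Fin n → Fin n} (P : IsPerfectMatching S p) (N : IsPerfectMatching S ν)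
                {x : Fin n} (Sx : S x) (νx≢px : ν x ≢ p x) where

    OnEdge : Pred (Fin n) 0ℓ
    OnEdge z = z ≡ x ⊎ z ≡ p x

    onEdge? : Decidable OnEdge
    onEdge? z = z ≟ x ⊎-dec z ≟ p x

    onEdge-p : ∀ {z} → OnEdge z → OnEdge (p z)
    onEdge-p (inj₁ refl) = inj₂ refl
    onEdge-p (inj₂ refl) = inj₁ (involutive P Sx)

    offEdge-p : ∀ {z} → S z → ¬ OnEdge z → ¬ OnEdge (p z)
    offEdge-p Sz z∉ e = z∉ (subst OnEdge (involutive P Sz) (onEdge-p e))

    onEdge-ν : ∀ {z} → OnEdge z → ¬ OnEdge (ν z)
    onEdge-ν (inj₁ refl) (inj₁ νx≡x)  = no-fixpoint N Sx νx≡x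
    onEdge-ν (inj₁ refl) (inj₂ νx≡px) = νx≢px νx≡px
    onEdge-ν (inj₂ refl) (inj₁ νpx≡x) =
      νx≢px (trans (cong ν (sym νpx≡x)) (involutive N (closed P Sx)))
    onEdge-ν (inj₂ refl) (inj₂ νpx≡px) = no-fixpoint N (closed P Sx) νpx≡px

    data Position (z : Fin n) : Set where
      onEdge   : OnEdge z → Position z
      nearEdge : ¬ OnEdge z → OnEdge (ν z) → Position z
      offEdge  : ¬ OnEdge z → ¬ OnEdge (ν z) → Position z

    position : ∀ z → Position z
    position z with onEdge? z | onEdge? (ν z)
    ... | yes e | _     = onEdge e
    ... | no ¬e | yes e = nearEdge ¬e e
    ... | no ¬e | no ¬f = offEdge ¬e ¬f

    switched : Fin n → Fin n
    switched z with position z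
    ... | onEdge _     = p z
    ... | nearEdge _ _ = ν (p (ν z))
    ... | offEdge _ _  = ν z

    switched-onEdge : ∀ {z} → OnEdge z → switched z ≡ p z
    switched-onEdge {z} e with position z
    ... | onEdge _      = refl
    ... | nearEdge ¬e _ = contradiction e ¬e
    ... | offEdge ¬e _  = contradiction e ¬e

    switched-nearEdge : ∀ {z} → ¬ OnEdge z → OnEdge (ν z) → switched z ≡ ν (p (ν z))
    switched-nearEdge {z} ¬e e′ with position z
    ... | onEdge e       = contradiction e ¬e
    ... | nearEdge _ _   = refl
    ... | offEdge _ ¬e′  = contradiction e′ ¬e′

    switched-offEdge : ∀ {z} → ¬ OnEdge z → ¬ OnEdge (ν z) → switched z ≡ ν z
    switched-offEdge {z} ¬e ¬e′ with position z
    ... | onEdge e      = contradiction e ¬e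
    ... | nearEdge _ e′ = contradiction e′ ¬e′
    ... | offEdge _ _   = refl

    switched-isPerfectMatching : IsPerfectMatching S switched
    switched-isPerfectMatching = record
      { closed = closed′ ; no-fixpoint = no-fixpoint′ ; involutive = involutive′ }
      where
      closed′ : ∀ {z} → S z → S (switched z)
      closed′ {z} Sz with position z
      ... | onEdge _     = closed P Sz
      ... | nearEdge _ _ = closed N (closed P (closed N Sz))
      ... | offEdge _ _  = closed N Sz

      no-fixpoint′ : ∀ {z} → S z → switched z ≢ z
      no-fixpoint′ {z} Sz with position z
      ... | onEdge _     = no-fixpoint P Sz
      ... | nearEdge _ _ = λ eq → no-fixpoint P (closed N Sz)
          (trans (sym (involutive N (closed P (closed N Sz)))) (cong ν eq))
      ... | offEdge _ _  = no-fixpoint N Sz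

      involutive′ : ∀ {z} → S z → switched (switched z) ≡ z
      involutive′ {z} Sz with position z
      ... | onEdge e = begin
        switched (p z) ≡⟨ switched-onEdge (onEdge-p e) ⟩
        p (p z)        ≡⟨ involutive P Sz ⟩
        z              ∎
      ... | nearEdge ¬e e′ = begin
        switched t        ≡⟨ switched-nearEdge (λ et → onEdge-ν et νt-onEdge) νt-onEdge ⟩
        ν (p (ν t))       ≡⟨ cong (ν ∘ p) νt≡pνz ⟩
        ν (p (p (ν z)))   ≡⟨ cong ν (involutive P (closed N Sz)) ⟩
        ν (ν z)           ≡⟨ involutive N Sz ⟩
        z                 ∎
        where
        t : Fin n
        t = ν (p (ν z))
        νt≡pνz : ν t ≡ p (ν z)
        νt≡pνz = involutive N (closed P (closed N Sz))
        νt-onEdge : OnEdge (ν t)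
        νt-onEdge = subst OnEdge (sym νt≡pνz) (onEdge-p e′)
      ... | offEdge ¬e ¬e′ = begin
        switched (ν z) ≡⟨ switched-offEdge ¬e′ (subst (λ w → ¬ OnEdge w) (sym (involutive N Sz)) ¬e) ⟩
        ν (ν z)        ≡⟨ involutive N Sz ⟩
        z              ∎

    switched-⊂ : (S? : Decidable S) → disagreement S? p switched ⊂ disagreement S? p ν
    switched-⊂ S? = shrinks , x , ∈-disagreement⁺ S? p ν Sx νx≢px , x∉
      where
      shrinks : ∀ {z} → z ∈ disagreement S? p switched → z ∈ disagreement S? p ν
      shrinks {z} z∈ with ∈-disagreement⁻ S? p switched z∈ | position z
      ... | Sz , sw≢p | onEdge e        = contradiction (switched-onEdge e) sw≢p
      ... | Sz , _    | nearEdge ¬e e′  = ∈-disagreement⁺ S? p ν Sz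
            (λ νz≡pz → offEdge-p Sz ¬e (subst OnEdge νz≡pz e′))
      ... | Sz , sw≢p | offEdge ¬e ¬e′  = ∈-disagreement⁺ S? p ν Sz
            (subst (_≢ p z) (switched-offEdge ¬e ¬e′) sw≢p)
      x∉ : x ∉ disagreement S? p switched
      x∉ x∈ = proj₂ (∈-disagreement⁻ S? p switched x∈) (switched-onEdge (inj₁ refl))

    lift : (Fin n → Bool) → Fin n → Bool
    lift f z with onEdge? z
    ... | yes _ = not (f (ν z))
    ... | no  _ = f z

    lift-onEdge : ∀ f {z} → OnEdge z → lift f z ≡ not (f (ν z))
    lift-onEdge f {z} e with onEdge? z
    ... | yes _ = refl
    ... | no ¬e = contradiction e ¬e

    lift-offEdge : ∀ f {z} → ¬ OnEdge z → lift f z ≡ f z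
    lift-offEdge f {z} ¬e with onEdge? z
    ... | yes e = contradiction e ¬e
    ... | no  _ = refl

    lift-proper-p : ∀ {f} → ProperColouring S p f → ProperColouring S switched f →
                    ProperColouring S p (lift f)
    lift-proper-p {f} fp fs {z} Sz with onEdge? z
    ... | yes e = λ eq → fs (closed N Sz) (begin
      f (switched (ν z))  ≡⟨ cong f (switched-nearEdge (onEdge-ν e) νν-onEdge) ⟩
      f (ν (p (ν (ν z)))) ≡⟨ cong (f ∘ ν ∘ p) (involutive N Sz) ⟩
      f (ν (p z))         ≡⟨ not-injective (trans (sym (lift-onEdge f (onEdge-p e))) eq) ⟩
      f (ν z)             ∎)
      where
      νν-onEdge : OnEdge (ν (ν z))
      νν-onEdge = subst OnEdge (sym (involutive N Sz)) e
    ... | no ¬e = λ eq → fp Sz (trans (sym (lift-offEdge f (offEdge-p Sz ¬e))) eq)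

    lift-proper-ν : ∀ {f} → ProperColouring S switched f → ProperColouring S ν (lift f)
    lift-proper-ν {f} fs {z} Sz eq with position z
    ... | onEdge e = not-¬ refl (begin
      f (ν z)        ≡˘⟨ lift-offEdge f (onEdge-ν e) ⟩
      lift f (ν z)   ≡⟨ eq ⟩
      lift f z       ≡⟨ lift-onEdge f e ⟩
      not (f (ν z))  ∎)
    ... | nearEdge ¬e e′ = not-¬ refl (begin
      f z              ≡˘⟨ lift-offEdge f ¬e ⟩
      lift f z         ≡˘⟨ eq ⟩
      lift f (ν z)     ≡⟨ lift-onEdge f e′ ⟩
      not (f (ν (ν z))) ≡⟨ cong (not ∘ f) (involutive N Sz) ⟩
      not (f z)        ∎)
    ... | offEdge ¬e ¬e′ = fs Sz (begin
      f (switched z) ≡⟨ cong f (switched-offEdge ¬e ¬e′) ⟩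
      f (ν z)        ≡˘⟨ lift-offEdge f ¬e′ ⟩
      lift f (ν z)   ≡⟨ eq ⟩
      lift f z       ≡⟨ lift-offEdge f ¬e ⟩
      f z            ∎)

  perfect-matchings-colourable :
    Decidable S → ∀ {p ν} → IsPerfectMatching S p → IsPerfectMatching S ν →
    ∃[ f ] ProperColouring S p f × ProperColouring S ν f
  perfect-matchings-colourable S? {p} P N₀ = go N₀ (⊂-wellFounded _)
    where
    go : ∀ {ν} → IsPerfectMatching S ν → Acc _⊂_ (disagreement S? p ν) →
         ∃[ f ] ProperColouring S p f × ProperColouring S ν f
    go {ν} N (acc smaller) with nonempty? (disagreement S? p ν)
    ... | no empty =
      let p-proper = order-colouring-proper P
      in _ , p-proper , proper-cong (λ Sz → sym (disagreement-empty S? p ν empty Sz)) p-proper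
    ... | yes (x , x∈) =
      let Sx , νx≢px = ∈-disagreement⁻ S? p ν x∈
          open Switch P N Sx νx≢px
          f , fp , fs = go switched-isPerfectMatching (smaller (switched-⊂ S?))
      in lift f , lift-proper-p fp fs , lift-proper-ν fs

module _ {m : ℕ} where

  toℕ-negℤ : ∀ {z : Fin (suc m)} → z ≢ zero → toℕ (negℤ z) ≡ suc m ∸ toℕ z
  toℕ-negℤ {zero}  z≢0 = contradiction refl z≢0
  toℕ-negℤ {suc k} _   = trans (toℕ-fromℕ< (m%n<n (m ∸ toℕ k) (suc m)))
                               (m<n⇒m%n≡m (s≤s (m∸n≤m m (toℕ k))))

  negℤ-nonzero : ∀ {z : Fin (suc m)} → z ≢ zero → negℤ z ≢ zero
  negℤ-nonzero {zero}  z≢0 = contradiction refl z≢0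
  negℤ-nonzero {suc k} z≢0 eq = m>n⇒m∸n≢0 (toℕ<n k) (trans (sym (toℕ-negℤ z≢0)) (cong toℕ eq))

  negℤ-involutive : ∀ {z : Fin (suc m)} → z ≢ zero → negℤ (negℤ z) ≡ z
  negℤ-involutive {z} z≢0 = toℕ-injective (begin
    toℕ (negℤ (negℤ z))     ≡⟨ toℕ-negℤ (negℤ-nonzero z≢0) ⟩
    suc m ∸ toℕ (negℤ z)    ≡⟨ cong (suc m ∸_) (toℕ-negℤ z≢0) ⟩
    suc m ∸ (suc m ∸ toℕ z) ≡⟨ m∸[m∸n]≡n (<⇒≤ (toℕ<n z)) ⟩
    toℕ z                   ∎)

negℤ-isPerfectMatching : ∀ q → IsPerfectMatching (_≢ zero) (negℤ {2 * q})
negℤ-isPerfectMatching q = record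
  { closed = negℤ-nonzero ; no-fixpoint = no-fixpoint′ ; involutive = negℤ-involutive }
  where
  no-fixpoint′ : ∀ {z : Fin (suc (2 * q))} → z ≢ zero → negℤ z ≢ z
  no-fixpoint′ {z} z≢0 eq = even≢odd (toℕ z) q (begin
    2 * toℕ z                       ≡⟨ cong (toℕ z +_) (+-identityʳ (toℕ z)) ⟩
    toℕ z + toℕ z                   ≡⟨ cong (_+ toℕ z) (trans (sym (cong toℕ eq)) (toℕ-negℤ z≢0)) ⟩
    (suc (2 * q) ∸ toℕ z) + toℕ z   ≡⟨ m∸n+n≡m (<⇒≤ (toℕ<n z)) ⟩
    suc (2 * q)                     ∎)

module _ {m q : ℕ} {a b : Fin q → Fin (suc m)} (part : Is2Partition q a b) where

  private
    pick≢0 : ∀ i s → pick a b i s ≢ zero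
    pick≢0 = proj₁ part

    covers : ∀ z → z ≢ zero → ∃[ i ] ∃[ s ] pick a b i s ≡ z
    covers = proj₁ (proj₂ part)

    pick-injective : ∀ i j s t → pick a b i s ≡ pick a b j t → i ≡ j × s ≡ t
    pick-injective = proj₂ (proj₂ part)

  partner : Fin (suc m) → Fin (suc m)
  partner z with z ≟ zero
  ... | yes _ = zero
  ... | no z≢0 with covers z z≢0
  ...   | i , s , _ = pick a b i (not s)

  partner-pick : ∀ i s → partner (pick a b i s) ≡ pick a b i (not s)
  partner-pick i s with pick a b i s ≟ zero
  ... | yes eq = contradiction eq (pick≢0 i s)
  ... | no z≢0 with covers (pick a b i s) z≢0
  ...   | j , t , eq with pick-injective j i t s eq
  ...     | refl , refl = refl

  partner-isPerfectMatching : IsPerfectMatching (_≢ zero) partner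
  partner-isPerfectMatching = record
    { closed = closed′ ; no-fixpoint = no-fixpoint′ ; involutive = involutive′ }
    where
    closed′ : ∀ {z} → z ≢ zero → partner z ≢ zero
    closed′ z≢0 with covers _ z≢0
    ... | i , s , refl = subst (_≢ zero) (sym (partner-pick i s)) (pick≢0 i (not s))

    no-fixpoint′ : ∀ {z} → z ≢ zero → partner z ≢ z
    no-fixpoint′ z≢0 with covers _ z≢0
    ... | i , s , refl = λ eq →
      not-¬ refl (sym (proj₂ (pick-injective i i (not s) s (trans (sym (partner-pick i s)) eq))))

    involutive′ : ∀ {z} → z ≢ zero → partner (partner z) ≡ z
    involutive′ z≢0 with covers _ z≢0
    ... | i , s , refl = begin
      partner (partner (pick a b i s)) ≡⟨ cong partner (partner-pick i s) ⟩
      partner (pick a b i (not s))     ≡⟨ partner-pick i (not s) ⟩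
      pick a b i (not (not s))         ≡⟨ cong (pick a b i) (not-involutive s) ⟩
      pick a b i s                     ∎

  true-coloured-is-chosen : ∀ {f} → ProperColouring (_≢ zero) partner f →
                            ∀ {z} → z ≢ zero → f z ≡ true → ∃[ i ] z ≡ pick a b i (f (a i))
  true-coloured-is-chosen {f} proper z≢0 fz with covers _ z≢0
  ... | i , true  , refl = i , cong (pick a b i) (sym fz)
  ... | i , false , refl = i , cong (pick a b i) (sym fai≡false)
    where
    fai≡false : f (a i) ≡ false
    fai≡false = ¬-not λ eq →
      proper (pick≢0 i false) (trans (cong f (partner-pick i false)) (trans eq (sym fz)))

  chosen-cover : ∀ {f g} → ProperColouring (_≢ zero) partner f →
                 IsPerfectMatching (_≢ zero) g → ProperColouring (_≢ zero) g f →
                 ∀ z → z ≢ zero → ∃[ i ] (z ≡ pick a b i (f (a i)) ⊎ z ≡ g (pick a b i (f (a i))))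
  chosen-cover {f} {g} partner-proper G g-proper z z≢0 with f z in fz
  ... | true  = map₂ inj₁ (true-coloured-is-chosen partner-proper z≢0 fz)
  ... | false = map₂ (λ gz≡chosen → inj₂ (trans (sym (involutive G z≢0)) (cong g gz≡chosen)))
                  (true-coloured-is-chosen partner-proper (closed G z≢0) fgz≡true)
    where
    fgz≡true : f (g z) ≡ true
    fgz≡true = ¬-not λ eq → g-proper z≢0 (trans eq (sym fz))

lemma2p1 : (q : ℕ) → q ≥ 1 →
    (a b : Fin q → Fin (suc (2 * q))) → Is2Partition q a b →
    Σ (Fin q → Bool) λ c → (∀ (z : Fin (suc (2 * q))) → z ≢ zero →
      ∃[ i ] (z ≡ pick a b i (c i) ⊎ z ≡ negℤ (pick a b i (c i))))
lemma2p1 q _ a b part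
  with perfect-matchings-colourable (λ z → ¬? (z ≟ zero))
         (partner-isPerfectMatching part) (negℤ-isPerfectMatching q)
... | f , partner-proper , negℤ-proper =
  (λ i → f (a i)) , chosen-cover part partner-proper (negℤ-isPerfectMatching q) negℤ-proper
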